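{- For every HOL term $M$ of HOL type $A$, \[ \Sigma\mid\alpha_{1}:\mathsf{type},\ldots,\alpha_{n}:\mathsf{type},x_{1}:\|A_{1}\|,\ldots,x_{m}:\|A_{m}\|\vdash|M|:\|A\| \] is derivable in the $\lambda\Pi$-calculus modulo rewriting, where $\alpha_{1},\ldots,\alpha_{n}$ are the free type variables and $x_{1}:A_{1},\ldots,x_{m}:A_{m}$ are the free term variables (with their HOL types) appearing in $M$.
   Context: The $\lambda\Pi$-calculus modulo rewriting (the theory of Dedukti) has terms $x\mid c\mid \mathsf{Type}\mid\mathsf{Kind}\mid \Pi x:A.\,B\mid \lambda x:A.\,M\mid M\,N$ ($A\to B$ abbreviates $\Pi x:A.\,B$ with $x$ not free in $B$). A signature $\Sigma$ is a list of constant declarations $c:A$ and rewrite rules $[\Gamma]\,M\leadsto N$; contexts are lists $x:A$. The judgment $\Sigma\mid\Gamma\vdash M:A$ is given by the rules: variables and constants get their declared type (in a well-formed context); $\Gamma\vdash\mathsf{Type}:\mathsf{Kind}$; if $\Gamma\vdash A:\mathsf{Type}$ and $\Gamma,x:A\vdash B:s$ ($s\in\{\mathsf{Type},\mathsf{Kind}\}$) then $\Gamma\vdash\Pi x:A.B:s$; if $\Gamma\vdash A:\mathsf{Type}$ and $\Gamma,x:A\vdash M:B$ then $\Gamma\vdash\lambda x:A.M:\Pi x:A.B$; if $\Gamma\vdash M:\Pi x:A.B$ and $\Gamma\vdash N:A$ then $\Gamma\vdash M\,N:[N/x]B$; if $\Gamma\vdash M:A$, $\Gamma\vdash B:\mathsf{Type}$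 and $A\equiv_{\beta\Sigma}B$ then $\Gamma\vdash M:B$, where $\equiv_{\beta\Sigma}$ is the congruence generated by $\beta$-reduction and the rewrite rules of $\Sigma$. Contexts are well formed when each declared type has type $\mathsf{Type}$. HOL: types are $A::=\alpha\mid p(A_1,\ldots,A_n)$ ($\alpha$ type variables, $p$ type operators; $\mathsf{bool},\mathsf{ind}$ are $0$-ary, $A\to B$ is the binary operator $\to(A,B)$). Terms are simply typed $\lambda$-terms $x\mid\lambda x:A.M\mid M\,N\mid c$, where each constant $c$ has a type possibly containing type variables and occurs as instances $c_{A_1,\ldots,A_n}$ (its type variables instantiated); in particular equality $(=_A)$ of type $A\to A\to\mathsf{bool}$ and choice $\mathsf{select}_A$ of type $(A\to\mathsf{bool})\to A$. $\Sigma$ is the signature containing: $\mathsf{type}:\mathsf{Type}$, $\mathsf{bool}:\mathsf{type}$, $\mathsf{ind}:\mathsf{type}$, $\mathsf{arrow}:\mathsf{type}\to\mathsf{type}\to\mathsf{type}$, and for each other $n$-ary HOL type operator $p$ a constant $p:\mathsf{type}\to\cdots\to\mathsf{type}\to\mathsf{type}$ ($n$ arguments); $\mathsf{term}:\mathsf{type}\to\mathsf{Type}$ with the rewrite rule $[\alpha:\mathsf{type},\beta:\mathsf{type}]\ \mathsf{term}\,(\mathsf{arrow}\,\alpha\,\beta)\leadsto \mathsf{term}\,\alpha\to\mathsf{term}\,\beta$; $\mathsf{eq}:\Pi\alpha:\mathsf{type}.\,\mathsf{term}(\mathsf{arrow}\,\alpha\,(\mathsf{arrow}\,\alpha\,\mathsf{bool}))$;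 $\mathsf{select}:\Pi\alpha:\mathsf{type}.\,\mathsf{term}(\mathsf{arrow}\,(\mathsf{arrow}\,\alpha\,\mathsf{bool})\,\alpha)$; for each other HOL constant $c$ of type $A$ with free type variables $\alpha_1,\ldots,\alpha_k$, $c:\Pi\alpha_1:\mathsf{type}\ldots\Pi\alpha_k:\mathsf{type}.\,\mathsf{term}\,|A|$; $\mathsf{proof}:\mathsf{term}\,\mathsf{bool}\to\mathsf{Type}$; and proof-rule constants $\mathsf{Refl},\mathsf{FunExt},\mathsf{AppThm},\mathsf{PropExt},\mathsf{EqMp}$ (whose types are irrelevant here). Translations: for HOL types, $|\alpha|=\alpha$, $|\mathsf{bool}|=\mathsf{bool}$, $|\mathsf{ind}|=\mathsf{ind}$, $|A\to B|=\mathsf{arrow}\,|A|\,|B|$, $|p(A_1,\ldots,A_n)|=p\,|A_1|\cdots|A_n|$, and $\|A\|=\mathsf{term}\,|A|$. For HOL terms, $|x|=x$, $|M\,N|=|M|\,|N|$, $|\lambda x:A.M|=\lambda x:\|A\|.\,|M|$, $|(=_A)|=\mathsf{eq}\,|A|$, $|\mathsf{select}_A|=\mathsf{select}\,|A|$, and $|c_{A_1,\ldots,A_n}|=c\,|A_1|\cdots|A_n|$. -}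

module Defs where

open import Data.Nat using (ℕ; zero; suc; _+_)
open import Data.Nat.Properties using () renaming (_≟_ to _≟ℕ_)
open import Data.Bool using (Bool; true; false; _∧_; not; if_then_else_)
open import Data.List using (List; []; _∷_; _++_; length; deduplicate; filterᵇ; reverse; map; foldr)
open import Data.Vec using (Vec; []; _∷_; toList)
open import Data.Product using (_×_; _,_; proj₁; proj₂)
open import Data.Maybe using (Maybe; just; nothing)
open import Relation.Nullary using (does)
open import Relation.Binary.Definitions using (DecidableEquality)
open import Relation.Binary.Construct.Closure.Equivalence using (EqClosure)
open import Relation.Binary.PropositionalEquality using (_≡_)

-- The "other" HOL type operators (besides bool, ind, →), with arities.
record TySig : Set₁ where
  field
    Op    : Set
    _≟Op_ : DecidableEquality Op
    arity : Op → ℕ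
open TySig public

data HTy (Θ : TySig) : Set where
  tvar : ℕ → HTy Θ
  bool : HTy Θ
  ind  : HTy Θ
  _⇒_  : HTy Θ → HTy Θ → HTy Θ
  tyop : (p : Op Θ) → Vec (HTy Θ) (arity Θ p) → HTy Θ

infixr 5 _⇒_

module _ {Θ : TySig} where
  mutual
    _==ty_ : HTy Θ → HTy Θ → Bool
    tvar a ==ty tvar b = does (a ≟ℕ b)
    bool ==ty bool = true
    ind ==ty ind = true
    (A ⇒ B) ==ty (C ⇒ D) = (A ==ty C) ∧ (B ==ty D)
    tyop p As ==ty tyop q Bs = does (_≟Op_ Θ p q) ∧ (As ==tys Bs)
    _ ==ty _ = false

    _==tys_ : ∀ {n m} → Vec (HTy Θ) n → Vec (HTy Θ) m → Bool
    [] ==tys [] = true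
    (A ∷ As) ==tys (B ∷ Bs) = (A ==ty B) ∧ (As ==tys Bs)
    _ ==tys _ = false

  mutual
    tvars : HTy Θ → List ℕ
    tvars (tvar a) = a ∷ []
    tvars bool = []
    tvars ind = []
    tvars (A ⇒ B) = tvars A ++ tvars B
    tvars (tyop p As) = tvarsV As

    tvarsV : ∀ {n} → Vec (HTy Θ) n → List ℕ
    tvarsV [] = []
    tvarsV (A ∷ As) = tvars A ++ tvarsV As

  ftv : HTy Θ → List ℕ
  ftv A = deduplicate _≟ℕ_ (tvars A)

  mutual
    tsub : (ℕ → HTy Θ) → HTy Θ → HTy Θ
    tsub σ (tvar a) = σ a
    tsub σ bool = bool
    tsub σ ind = ind
    tsub σ (A ⇒ B) = tsub σ A ⇒ tsub σ B
    tsub σ (tyop p As) = tyop p (tsubV σ As)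

    tsubV : ∀ {n} → (ℕ → HTy Θ) → Vec (HTy Θ) n → Vec (HTy Θ) n
    tsubV σ [] = []
    tsubV σ (A ∷ As) = tsub σ A ∷ tsubV σ As

  instSub : List ℕ → List (HTy Θ) → ℕ → HTy Θ
  instSub (α ∷ αs) (A ∷ As) β = if does (α ≟ℕ β) then A else instSub αs As β
  instSub _ _ β = tvar β

-- A HOL signature: type operators and the other constants with their types
-- (equality and select are built in, see HTm).
record HOLSig : Set₁ where
  field
    tsig  : TySig
    Con   : Set
    ctype : Con → HTy tsig
open HOLSig public

data HTm (S : HOLSig) : Set where
  var  : ℕ → HTy (tsig S) → HTm S
  lam  : ℕ → HTy (tsig S) → HTm S → HTm S
  app  : HTm S → HTm S → HTm S
  eqC  : HTy (tsig S) → HTm S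
  selC : HTy (tsig S) → HTm S
  con  : (c : Con S) → Vec (HTy (tsig S)) (length (ftv (ctype S c))) → HTm S

module _ {S : HOLSig} where
  private Ty = HTy (tsig S)

  data _⦂_ : HTm S → Ty → Set where
    var  : ∀ {x A} → var x A ⦂ A
    lam  : ∀ {x A M B} → M ⦂ B → lam x A M ⦂ (A ⇒ B)
    app  : ∀ {M N A B} → M ⦂ (A ⇒ B) → N ⦂ A → app M N ⦂ B
    eqC  : ∀ {A} → eqC A ⦂ (A ⇒ A ⇒ bool)
    selC : ∀ {A} → selC A ⦂ ((A ⇒ bool) ⇒ A)
    con  : ∀ {c As} →
           con c As ⦂ tsub (instSub (ftv (ctype S c)) (toList As)) (ctype S c)

  ftvTm : HTm S → List ℕ
  ftvTm (var x A) = tvars A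
  ftvTm (lam x A M) = tvars A ++ ftvTm M
  ftvTm (app M N) = ftvTm M ++ ftvTm N
  ftvTm (eqC A) = tvars A
  ftvTm (selC A) = tvars A
  ftvTm (con c As) = tvarsV As

  fvTm : HTm S → List (ℕ × Ty)
  fvTm (var x A) = (x , A) ∷ []
  fvTm (lam x A M) =
    filterᵇ (λ v → not (does (proj₁ v ≟ℕ x) ∧ (proj₂ v ==ty A))) (fvTm M)
  fvTm (app M N) = fvTm M ++ fvTm N
  fvTm (eqC A) = []
  fvTm (selC A) = []
  fvTm (con c As) = []

data RuleC : Set where
  Refl FunExt AppThm PropExt EqMp : RuleC

data DConst (S : HOLSig) : Set where
  type bool ind arrow term eq select proof : DConst S
  op   : Op (tsig S) → DConst S
  con  : Con S → DConst S
  rule : RuleC → DConst S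

data DTm (S : HOLSig) : Set where
  var  : ℕ → DTm S
  cst  : DConst S → DTm S
  TYPE : DTm S
  KIND : DTm S
  Π    : DTm S → DTm S → DTm S
  ƛ    : DTm S → DTm S → DTm S
  _·_  : DTm S → DTm S → DTm S

infixl 9 _·_

module _ {S : HOLSig} where
  private T = DTm S

  ext : (ℕ → ℕ) → ℕ → ℕ
  ext ρ zero = zero
  ext ρ (suc n) = suc (ρ n)

  ren : (ℕ → ℕ) → T → T
  ren ρ (var n) = var (ρ n)
  ren ρ (cst c) = cst c
  ren ρ TYPE = TYPE
  ren ρ KIND = KIND
  ren ρ (Π A B) = Π (ren ρ A) (ren (ext ρ) B)
  ren ρ (ƛ A M) = ƛ (ren ρ A) (ren (ext ρ) M)
  ren ρ (M · N) = ren ρ M · ren ρ N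

  wk : T → T
  wk = ren suc

  exts : (ℕ → T) → ℕ → T
  exts σ zero = var zero
  exts σ (suc n) = wk (σ n)

  sub : (ℕ → T) → T → T
  sub σ (var n) = σ n
  sub σ (cst c) = cst c
  sub σ TYPE = TYPE
  sub σ KIND = KIND
  sub σ (Π A B) = Π (sub σ A) (sub (exts σ) B)
  sub σ (ƛ A M) = ƛ (sub σ A) (sub (exts σ) M)
  sub σ (M · N) = sub σ M · sub σ N

  _[_]₀ : T → T → T
  B [ N ]₀ = sub (λ { zero → N ; (suc n) → var n }) B

  _⟶_ : T → T → T
  A ⟶ B = Π A (wk B)
  infixr 5 _⟶_

  typeArrows : ℕ → T
  typeArrows zero = cst type
  typeArrows (suc n) = cst type ⟶ typeArrows n

  piTypes : ℕ → T → T
  piTypes zero B = B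
  piTypes (suc k) B = Π (cst type) (piTypes k B)

  apps : T → List T → T
  apps M [] = M
  apps M (N ∷ Ns) = apps (M · N) Ns

  data _↝_ : T → T → Set where
    β     : ∀ {A M N} → (ƛ A M · N) ↝ (M [ N ]₀)
    rw    : ∀ {a b} → (cst term · (cst arrow · a · b)) ↝ (cst term · a ⟶ cst term · b)
    Πˡ    : ∀ {A A' B} → A ↝ A' → Π A B ↝ Π A' B
    Πʳ    : ∀ {A B B'} → B ↝ B' → Π A B ↝ Π A B'
    ƛˡ    : ∀ {A A' M} → A ↝ A' → ƛ A M ↝ ƛ A' M
    ƛʳ    : ∀ {A M M'} → M ↝ M' → ƛ A M ↝ ƛ A M'
    appˡ  : ∀ {M M' N} → M ↝ M' → (M · N) ↝ (M' · N)
    appʳ  : ∀ {M N N'} → N ↝ N' → (M · N) ↝ (M · N')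

  _≡βΣ_ : T → T → Set
  _≡βΣ_ = EqClosure _↝_

-- HOL type translation needs names: a scope lists the names of the
-- Dedukti context, most recent first (index 0).
data DName (S : HOLSig) : Set where
  tyN : ℕ → DName S
  tmN : ℕ → HTy (tsig S) → DName S

module _ {S : HOLSig} where
  private T = DTm S
  private Ty = HTy (tsig S)

  _==n_ : DName S → DName S → Bool
  tyN a ==n tyN b = does (a ≟ℕ b)
  tmN x A ==n tmN y B = does (x ≟ℕ y) ∧ (A ==ty B)
  _ ==n _ = false

  index : List (DName S) → DName S → ℕ
  index [] v = zero
  index (w ∷ s) v = if w ==n v then zero else suc (index s v)

  mutual
    trTy : List (DName S) → Ty → T
    trTy s (tvar α) = var (index s (tyN α))
    trTy s bool = cst bool
    trTy s ind = cst ind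
    trTy s (A ⇒ B) = cst arrow · trTy s A · trTy s B
    trTy s (tyop p As) = apps (cst (op p)) (trTys s As)

    trTys : ∀ {n} → List (DName S) → Vec Ty n → List T
    trTys s [] = []
    trTys s (A ∷ As) = trTy s A ∷ trTys s As

  ‖_∣_‖ : List (DName S) → Ty → T
  ‖ s ∣ A ‖ = cst term · trTy s A

  trTm : List (DName S) → HTm S → T
  trTm s (var x A) = var (index s (tmN x A))
  trTm s (lam x A M) = ƛ ‖ s ∣ A ‖ (trTm (tmN x A ∷ s) M)
  trTm s (app M N) = trTm s M · trTm s N
  trTm s (eqC A) = cst eq · trTy s A
  trTm s (selC A) = cst select · trTy s A
  trTm s (con c As) = apps (cst (con c)) (trTys s As)

  -- types of the constants of Σ (R gives the irrelevant types of the proof rules)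
  ctyp : (RuleC → T) → DConst S → T
  ctyp R type = TYPE
  ctyp R bool = cst type
  ctyp R ind = cst type
  ctyp R arrow = typeArrows 2
  ctyp R term = Π (cst type) TYPE
  ctyp R eq = Π (cst type) (cst term · (cst arrow · var 0 · (cst arrow · var 0 · cst bool)))
  ctyp R select = Π (cst type) (cst term · (cst arrow · (cst arrow · var 0 · cst bool) · var 0))
  ctyp R proof = Π (cst term · cst bool) TYPE
  ctyp R (op p) = typeArrows (arity (tsig S) p)
  ctyp R (con c) =
    piTypes (length (ftv (ctype S c)))
            ‖ reverse (map tyN (ftv (ctype S c))) ∣ ctype S c ‖
  ctyp R (rule r) = R r

  -- contexts, most recent declaration first
  Ctx : Set
  Ctx = List T

  lookupCtx : Ctx → ℕ → Maybe T
  lookupCtx [] n = nothing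
  lookupCtx (A ∷ Γ) zero = just A
  lookupCtx (A ∷ Γ) (suc n) = lookupCtx Γ n

  data IsSort : T → Set where
    sType : IsSort TYPE
    sKind : IsSort KIND

  mutual
    data WF (R : RuleC → T) : Ctx → Set where
      ε   : WF R []
      _▸_ : ∀ {Γ A} → WF R Γ → Typed R Γ A TYPE → WF R (A ∷ Γ)

    data Typed (R : RuleC → T) : Ctx → T → T → Set where
      var  : ∀ {Γ i A} → WF R Γ → lookupCtx Γ i ≡ just A →
             Typed R Γ (var i) (ren (λ k → suc i + k) A)
      cst  : ∀ {Γ} c → WF R Γ → Typed R Γ (cst c) (ctyp R c)
      sort : ∀ {Γ} → WF R Γ → Typed R Γ TYPE KIND
      pi   : ∀ {Γ A B s} → IsSort s → Typed R Γ A TYPE → Typed R (A ∷ Γ) B s →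
             Typed R Γ (Π A B) s
      lam  : ∀ {Γ A M B} → Typed R Γ A TYPE → Typed R (A ∷ Γ) M B →
             Typed R Γ (ƛ A M) (Π A B)
      app  : ∀ {Γ M N A B} → Typed R Γ M (Π A B) → Typed R Γ N A →
             Typed R Γ (M · N) (B [ N ]₀)
      conv : ∀ {Γ M A B} → Typed R Γ M A → Typed R Γ B TYPE → A ≡βΣ B →
             Typed R Γ M B

  addTyVars : Ctx × List (DName S) → List ℕ → Ctx × List (DName S)
  addTyVars (Γ , s) [] = Γ , s
  addTyVars (Γ , s) (α ∷ αs) = addTyVars (cst type ∷ Γ , tyN α ∷ s) αs

  addTmVars : Ctx × List (DName S) → List (ℕ × Ty) → Ctx × List (DName S)
  addTmVars (Γ , s) [] = Γ , s
  addTmVars (Γ , s) ((x , A) ∷ xs) = addTmVars (‖ s ∣ A ‖ ∷ Γ , tmN x A ∷ s) xs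

  holCtx : List ℕ → List (ℕ × Ty) → Ctx × List (DName S)
  holCtx αs xs = addTmVars (addTyVars ([] , []) αs) xs

module Submission where

-- We prove a compositional generalisation and specialise it at the end.  A
-- Dedukti context Γ with scope s (the HOL names bound in Γ, innermost first)
-- is *scoped* if it is a block of declarations α : type followed by a block of
-- declarations x : ‖A‖, each ‖A‖ translated in the scope preceding it.  The
-- main lemma `translation-typed` says that in a well-formed scoped context
-- declaring all type variables and free variables of M, a HOL derivation of
-- M : A gives Γ ⊢ |M| : ‖A‖.  It goes by induction on the HOL derivation; the
-- only non-routine case is a polymorphic constant, whose Dedukti type
-- Π α₁…αₖ : type. ‖C‖ instantiated at |A₁| … |Aₖ| must be shown to be
-- ‖C[A₁/α₁,…,Aₖ/αₖ]‖.

open import Defs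
open import Function using (_∘_)
open import Data.Nat using (ℕ; zero; suc; _+_; _≡ᵇ_)
open import Data.Nat.Properties using (_≟_; suc-injective)
open import Data.Bool using (true; false; _∧_; not; T)
open import Data.Unit using (tt)
open import Data.Empty using (⊥-elim)
open import Data.List using (List; []; _∷_; _++_; length; map; reverse; _ʳ++_)
open import Data.Vec using (Vec; []; _∷_; toList)
open import Data.Product using (_×_; _,_; proj₁; proj₂; Σ-syntax)
open import Data.Sum using (_⊎_; inj₁; inj₂; [_,_]′)
open import Data.Maybe using (just)
open import Relation.Nullary using (yes; no) renaming (proof to dec-proof)
open import Relation.Nullary.Reflects using (Reflects; ofʸ; ofⁿ; _×-reflects_)
open import Relation.Binary.PropositionalEquality
  using (_≡_; refl; sym; trans; cong; cong₂; subst; _≗_)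
open import Data.List.Membership.Propositional using (_∈_; _∉_)
open import Data.List.Membership.Propositional.Properties
  using (∈-++⁻; ∈-filter⁺; ∈-filter⁻; ∈-deduplicate⁺)
open import Data.List.Relation.Unary.Any using (here; there)
open import Data.List.Relation.Unary.All.Properties using (All¬⇒¬Any)
open import Data.List.Relation.Unary.AllPairs using (_∷_)
open import Data.List.Relation.Unary.Unique.Propositional using (Unique)
open import Data.List.Relation.Unary.Unique.DecPropositional.Properties _≟_
  using (deduplicate-!)
open import Data.List.Relation.Binary.Subset.Propositional using (_⊆_)
open import Data.List.Relation.Binary.Subset.Propositional.Properties
  using (⊆-refl; xs⊆xs++ys; xs⊆ys++xs; ++⁺ʳ)
open import Relation.Binary.Construct.Closure.ReflexiveTransitive using (ε; _◅_)
open import Relation.Binary.Construct.Closure.Symmetric using (fwd; bwd)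

-- Names are compared with `_≡ᵇ_`, to which `does (m ≟ n)` computes.
≡ᵇ-reflects : (m n : ℕ) → Reflects (m ≡ n) (m ≡ᵇ n)
≡ᵇ-reflects m n = dec-proof (m ≟ n)

reflects-map : ∀ {a b} {P : Set a} {Q : Set b} {c} →
               (P → Q) → (Q → P) → Reflects P c → Reflects Q c
reflects-map f g (ofʸ p) = ofʸ (f p)
reflects-map f g (ofⁿ ¬p) = ofⁿ (¬p ∘ g)

++-⊆ : ∀ {a} {A : Set a} {xs ys zs : List A} → xs ⊆ zs → ys ⊆ zs → xs ++ ys ⊆ zs
++-⊆ {xs = xs} xs⊆ ys⊆ = [ xs⊆ , ys⊆ ]′ ∘ ∈-++⁻ xs

module _ {S : HOLSig} where
  private
    Tm    = DTm S
    Ty    = HTy (tsig S)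
    Scope = List (DName S)

  mutual
    ==ty-reflects : (A B : Ty) → Reflects (A ≡ B) (A ==ty B)
    ==ty-reflects (tvar a) (tvar b) =
      reflects-map (cong tvar) (λ { refl → refl }) (≡ᵇ-reflects a b)
    ==ty-reflects bool bool = ofʸ refl
    ==ty-reflects ind ind = ofʸ refl
    ==ty-reflects (A ⇒ B) (C ⇒ D) =
      reflects-map (λ { (refl , refl) → refl }) (λ { refl → refl , refl })
                   (==ty-reflects A C ×-reflects ==ty-reflects B D)
    ==ty-reflects (tyop p As) (tyop q Bs) with _≟Op_ (tsig S) p q
    ... | yes refl = reflects-map (cong (tyop p)) (λ { refl → refl }) (==tys-reflects As Bs)
    ... | no p≢q   = ofⁿ λ { refl → p≢q refl }
    ==ty-reflects (tvar _) bool = ofⁿ λ ()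
    ==ty-reflects (tvar _) ind = ofⁿ λ ()
    ==ty-reflects (tvar _) (_ ⇒ _) = ofⁿ λ ()
    ==ty-reflects (tvar _) (tyop _ _) = ofⁿ λ ()
    ==ty-reflects bool (tvar _) = ofⁿ λ ()
    ==ty-reflects bool ind = ofⁿ λ ()
    ==ty-reflects bool (_ ⇒ _) = ofⁿ λ ()
    ==ty-reflects bool (tyop _ _) = ofⁿ λ ()
    ==ty-reflects ind (tvar _) = ofⁿ λ ()
    ==ty-reflects ind bool = ofⁿ λ ()
    ==ty-reflects ind (_ ⇒ _) = ofⁿ λ ()
    ==ty-reflects ind (tyop _ _) = ofⁿ λ ()
    ==ty-reflects (_ ⇒ _) (tvar _) = ofⁿ λ ()
    ==ty-reflects (_ ⇒ _) bool = ofⁿ λ ()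
    ==ty-reflects (_ ⇒ _) ind = ofⁿ λ ()
    ==ty-reflects (_ ⇒ _) (tyop _ _) = ofⁿ λ ()
    ==ty-reflects (tyop _ _) (tvar _) = ofⁿ λ ()
    ==ty-reflects (tyop _ _) bool = ofⁿ λ ()
    ==ty-reflects (tyop _ _) ind = ofⁿ λ ()
    ==ty-reflects (tyop _ _) (_ ⇒ _) = ofⁿ λ ()

    ==tys-reflects : ∀ {n} (As Bs : Vec Ty n) → Reflects (As ≡ Bs) (As ==tys Bs)
    ==tys-reflects [] [] = ofʸ refl
    ==tys-reflects (A ∷ As) (B ∷ Bs) =
      reflects-map (λ { (refl , refl) → refl }) (λ { refl → refl , refl })
                   (==ty-reflects A B ×-reflects ==tys-reflects As Bs)

  tmN-reflects : ∀ y x (B A : Ty) → Reflects (y ≡ x × B ≡ A) ((y ≡ᵇ x) ∧ (B ==ty A))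
  tmN-reflects y x B A = ≡ᵇ-reflects y x ×-reflects ==ty-reflects B A

  index-tyN-here : ∀ α (ns : Scope) → index (tyN α ∷ ns) (tyN α) ≡ 0
  index-tyN-here α ns with α ≡ᵇ α | ≡ᵇ-reflects α α
  ... | true  | _        = refl
  ... | false | ofⁿ α≢α = ⊥-elim (α≢α refl)

  ext-cong : ∀ {ρ ρ' : ℕ → ℕ} → ρ ≗ ρ' → ext {S} ρ ≗ ext {S} ρ'
  ext-cong h zero = refl
  ext-cong h (suc x) = cong suc (h x)

  ren-cong : ∀ {ρ ρ'} → ρ ≗ ρ' → (M : Tm) → ren ρ M ≡ ren ρ' M
  ren-cong h (var n) = cong var (h n)
  ren-cong h (cst c) = refl
  ren-cong h TYPE = refl
  ren-cong h KIND = refl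
  ren-cong h (Π A B) = cong₂ Π (ren-cong h A) (ren-cong (ext-cong h) B)
  ren-cong h (ƛ A M) = cong₂ ƛ (ren-cong h A) (ren-cong (ext-cong h) M)
  ren-cong h (M · N) = cong₂ _·_ (ren-cong h M) (ren-cong h N)

  exts-cong : ∀ {σ σ' : ℕ → Tm} → σ ≗ σ' → exts σ ≗ exts σ'
  exts-cong h zero = refl
  exts-cong h (suc x) = cong wk (h x)

  sub-cong : ∀ {σ σ'} → σ ≗ σ' → (M : Tm) → sub σ M ≡ sub σ' M
  sub-cong h (var n) = h n
  sub-cong h (cst c) = refl
  sub-cong h TYPE = refl
  sub-cong h KIND = refl
  sub-cong h (Π A B) = cong₂ Π (sub-cong h A) (sub-cong (exts-cong h) B)
  sub-cong h (ƛ A M) = cong₂ ƛ (sub-cong h A) (sub-cong (exts-cong h) M)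
  sub-cong h (M · N) = cong₂ _·_ (sub-cong h M) (sub-cong h N)

  ext-∘ : ∀ ρ ρ' → ext {S} ρ ∘ ext {S} ρ' ≗ ext {S} (ρ ∘ ρ')
  ext-∘ ρ ρ' zero = refl
  ext-∘ ρ ρ' (suc x) = refl

  exts-∘-ext : ∀ (σ : ℕ → Tm) ρ → exts σ ∘ ext {S} ρ ≗ exts (σ ∘ ρ)
  exts-∘-ext σ ρ zero = refl
  exts-∘-ext σ ρ (suc x) = refl

  ren-ren : ∀ ρ ρ' (M : Tm) → ren ρ (ren ρ' M) ≡ ren (ρ ∘ ρ') M
  ren-ren ρ ρ' (var n) = refl
  ren-ren ρ ρ' (cst c) = refl
  ren-ren ρ ρ' TYPE = refl
  ren-ren ρ ρ' KIND = refl
  ren-ren ρ ρ' (Π A B) =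
    cong₂ Π (ren-ren ρ ρ' A) (trans (ren-ren (ext {S} ρ) (ext {S} ρ') B) (ren-cong (ext-∘ ρ ρ') B))
  ren-ren ρ ρ' (ƛ A M) =
    cong₂ ƛ (ren-ren ρ ρ' A) (trans (ren-ren (ext {S} ρ) (ext {S} ρ') M) (ren-cong (ext-∘ ρ ρ') M))
  ren-ren ρ ρ' (M · N) = cong₂ _·_ (ren-ren ρ ρ' M) (ren-ren ρ ρ' N)

  sub-ren : ∀ σ ρ (M : Tm) → sub σ (ren ρ M) ≡ sub (σ ∘ ρ) M
  sub-ren σ ρ (var n) = refl
  sub-ren σ ρ (cst c) = refl
  sub-ren σ ρ TYPE = refl
  sub-ren σ ρ KIND = refl
  sub-ren σ ρ (Π A B) =
    cong₂ Π (sub-ren σ ρ A) (trans (sub-ren (exts σ) (ext {S} ρ) B) (sub-cong (exts-∘-ext σ ρ) B))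
  sub-ren σ ρ (ƛ A M) =
    cong₂ ƛ (sub-ren σ ρ A) (trans (sub-ren (exts σ) (ext {S} ρ) M) (sub-cong (exts-∘-ext σ ρ) M))
  sub-ren σ ρ (M · N) = cong₂ _·_ (sub-ren σ ρ M) (sub-ren σ ρ N)

  ren-ext-∘-exts : ∀ ρ (σ : ℕ → Tm) → ren (ext {S} ρ) ∘ exts σ ≗ exts (ren ρ ∘ σ)
  ren-ext-∘-exts ρ σ zero = refl
  ren-ext-∘-exts ρ σ (suc x) = trans (ren-ren (ext {S} ρ) suc (σ x)) (sym (ren-ren suc ρ (σ x)))

  ren-sub : ∀ ρ σ (M : Tm) → ren ρ (sub σ M) ≡ sub (ren ρ ∘ σ) M
  ren-sub ρ σ (var n) = refl
  ren-sub ρ σ (cst c) = refl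
  ren-sub ρ σ TYPE = refl
  ren-sub ρ σ KIND = refl
  ren-sub ρ σ (Π A B) =
    cong₂ Π (ren-sub ρ σ A) (trans (ren-sub (ext {S} ρ) (exts σ) B) (sub-cong (ren-ext-∘-exts ρ σ) B))
  ren-sub ρ σ (ƛ A M) =
    cong₂ ƛ (ren-sub ρ σ A) (trans (ren-sub (ext {S} ρ) (exts σ) M) (sub-cong (ren-ext-∘-exts ρ σ) M))
  ren-sub ρ σ (M · N) = cong₂ _·_ (ren-sub ρ σ M) (ren-sub ρ σ N)

  sub-exts-∘-exts : ∀ (σ τ : ℕ → Tm) → sub (exts σ) ∘ exts τ ≗ exts (sub σ ∘ τ)
  sub-exts-∘-exts σ τ zero = refl
  sub-exts-∘-exts σ τ (suc x) = trans (sub-ren (exts σ) suc (τ x)) (sym (ren-sub suc σ (τ x)))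

  sub-sub : ∀ σ τ (M : Tm) → sub σ (sub τ M) ≡ sub (sub σ ∘ τ) M
  sub-sub σ τ (var n) = refl
  sub-sub σ τ (cst c) = refl
  sub-sub σ τ TYPE = refl
  sub-sub σ τ KIND = refl
  sub-sub σ τ (Π A B) =
    cong₂ Π (sub-sub σ τ A) (trans (sub-sub (exts σ) (exts τ) B) (sub-cong (sub-exts-∘-exts σ τ) B))
  sub-sub σ τ (ƛ A M) =
    cong₂ ƛ (sub-sub σ τ A) (trans (sub-sub (exts σ) (exts τ) M) (sub-cong (sub-exts-∘-exts σ τ) M))
  sub-sub σ τ (M · N) = cong₂ _·_ (sub-sub σ τ M) (sub-sub σ τ N)

  exts-var : exts {S} var ≗ var
  exts-var zero = refl
  exts-var (suc x) = refl

  sub-id : (M : Tm) → sub var M ≡ M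
  sub-id (var n) = refl
  sub-id (cst c) = refl
  sub-id TYPE = refl
  sub-id KIND = refl
  sub-id (Π A B) = cong₂ Π (sub-id A) (trans (sub-cong exts-var B) (sub-id B))
  sub-id (ƛ A M) = cong₂ ƛ (sub-id A) (trans (sub-cong exts-var M) (sub-id M))
  sub-id (M · N) = cong₂ _·_ (sub-id M) (sub-id N)

  sub-wk : ∀ {σ} → σ ∘ suc ≗ var → (X : Tm) → sub σ (wk X) ≡ X
  sub-wk {σ} h X = trans (sub-ren σ suc X) (trans (sub-cong h X) (sub-id X))

  ren-apps : ∀ ρ (F : Tm) Ns → ren ρ (apps F Ns) ≡ apps (ren ρ F) (map (ren ρ) Ns)
  ren-apps ρ F [] = refl
  ren-apps ρ F (N ∷ Ns) = ren-apps ρ (F · N) Ns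

  sub-apps : ∀ σ (F : Tm) Ns → sub σ (apps F Ns) ≡ apps (sub σ F) (map (sub σ) Ns)
  sub-apps σ F [] = refl
  sub-apps σ F (N ∷ Ns) = sub-apps σ (F · N) Ns

  mutual
    -- Declaring a term variable shifts the indices of all type variables, so
    -- translating in the extended scope is weakening.
    wk-trTy : ∀ (s : Scope) x B (A : Ty) → wk (trTy s A) ≡ trTy (tmN x B ∷ s) A
    wk-trTy s x B (tvar α) = refl
    wk-trTy s x B bool = refl
    wk-trTy s x B ind = refl
    wk-trTy s x B (A ⇒ A') =
      cong₂ (λ a b → cst arrow · a · b) (wk-trTy s x B A) (wk-trTy s x B A')
    wk-trTy s x B (tyop p As) =
      trans (ren-apps suc (cst (op p)) (trTys s As)) (cong (apps (cst (op p))) (wk-trTys s x B As))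

    wk-trTys : ∀ (s : Scope) x B {n} (As : Vec Ty n) → map wk (trTys s As) ≡ trTys (tmN x B ∷ s) As
    wk-trTys s x B [] = refl
    wk-trTys s x B (A ∷ As) = cong₂ _∷_ (wk-trTy s x B A) (wk-trTys s x B As)

  mutual
    sub-trTy : ∀ σ (s₀ s : Scope) (ϑ : ℕ → Ty) (C : Ty) →
               (∀ {α} → α ∈ tvars C → σ (index s₀ (tyN α)) ≡ trTy s (ϑ α)) →
               sub σ (trTy s₀ C) ≡ trTy s (tsub ϑ C)
    sub-trTy σ s₀ s ϑ (tvar α) h = h (here refl)
    sub-trTy σ s₀ s ϑ bool h = refl
    sub-trTy σ s₀ s ϑ ind h = refl
    sub-trTy σ s₀ s ϑ (A ⇒ B) h =
      cong₂ (λ a b → cst arrow · a · b) (sub-trTy σ s₀ s ϑ A (h ∘ xs⊆xs++ys _ _))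
                                        (sub-trTy σ s₀ s ϑ B (h ∘ xs⊆ys++xs _ (tvars A)))
    sub-trTy σ s₀ s ϑ (tyop p As) h =
      trans (sub-apps σ (cst (op p)) (trTys s₀ As)) (cong (apps (cst (op p))) (sub-trTys σ s₀ s ϑ As h))

    sub-trTys : ∀ σ (s₀ s : Scope) (ϑ : ℕ → Ty) {n} (As : Vec Ty n) →
                (∀ {α} → α ∈ tvarsV As → σ (index s₀ (tyN α)) ≡ trTy s (ϑ α)) →
                map (sub σ) (trTys s₀ As) ≡ trTys s (tsubV ϑ As)
    sub-trTys σ s₀ s ϑ [] h = refl
    sub-trTys σ s₀ s ϑ (A ∷ As) h =
      cong₂ _∷_ (sub-trTy σ s₀ s ϑ A (h ∘ xs⊆xs++ys _ _))
                (sub-trTys σ s₀ s ϑ As (h ∘ xs⊆ys++xs _ (tvars A)))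

  length-trTys : ∀ (s : Scope) {n} (As : Vec Ty n) → length (trTys s As) ≡ n
  length-trTys s [] = refl
  length-trTys s (A ∷ As) = cong suc (length-trTys s As)

  ren-piTypes-type : ∀ ρ n → ren ρ (piTypes {S} n (cst type)) ≡ piTypes n (cst type)
  ren-piTypes-type ρ zero = refl
  ren-piTypes-type ρ (suc n) = cong (Π (cst type)) (ren-piTypes-type (ext {S} ρ) n)

  typeArrows≡piTypes : ∀ n → typeArrows {S} n ≡ piTypes n (cst type)
  typeArrows≡piTypes zero = refl
  typeArrows≡piTypes (suc n) =
    cong (Π (cst type)) (trans (cong wk (typeArrows≡piTypes n)) (ren-piTypes-type suc n))

  _•_ : Tm → (ℕ → Tm) → ℕ → Tm
  (N • σ) zero = N
  (N • σ) (suc x) = σ x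

  ⟪_⟫ : List Tm → ℕ → Tm
  ⟪ [] ⟫ = var
  ⟪ N ∷ Ns ⟫ = N • ⟪ Ns ⟫

  exts-[]₀ : ∀ N σ → (λ x → exts σ x [ N ]₀) ≗ (N • σ)
  exts-[]₀ N σ zero = refl
  exts-[]₀ N σ (suc x) = sub-wk (λ _ → refl) (σ x)

  lockstep-skip : ∀ fs (Ns Ms : List Tm) (ns : Scope) {α} → α ∉ fs → length Ns ≡ length fs →
                  ⟪ Ns ʳ++ Ms ⟫ (index (map tyN fs ʳ++ ns) (tyN α)) ≡ ⟪ Ms ⟫ (index ns (tyN α))
  lockstep-skip [] [] Ms ns α∉ len = refl
  lockstep-skip (f ∷ fs) (N ∷ Ns) Ms ns {α} α∉ len =
    trans (lockstep-skip fs Ns (N ∷ Ms) (tyN f ∷ ns) (α∉ ∘ there) (suc-injective len)) skip-f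
    where
      skip-f : ⟪ N ∷ Ms ⟫ (index (tyN f ∷ ns) (tyN α)) ≡ ⟪ Ms ⟫ (index ns (tyN α))
      skip-f with f ≡ᵇ α | ≡ᵇ-reflects f α
      ... | true  | ofʸ refl = ⊥-elim (α∉ (here refl))
      ... | false | _        = refl

  -- A polymorphic constant binds its distinct type variables fs in reverse
  -- order; substituting its arguments |A₁| … |Aₖ| for these binders sends
  -- α ∈ fs to the translation of the instance instSub fs As α.  The
  -- accumulators Ms and ns (reverse xs is xs ʳ++ []) make the claim inductive.
  instantiate-tyvar : ∀ (s : Scope) fs → Unique fs → (As : Vec Ty (length fs)) (Ms : List Tm) (ns : Scope) →
                      ∀ {α} → α ∈ fs →
                      ⟪ trTys s As ʳ++ Ms ⟫ (index (map tyN fs ʳ++ ns) (tyN α))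
                        ≡ trTy s (instSub fs (toList As) α)
  instantiate-tyvar s (f ∷ fs) (f∉fs ∷ fs!) (A ∷ As) Ms ns {α} α∈ with f ≡ᵇ α | ≡ᵇ-reflects f α
  ... | true  | ofʸ refl =
    trans (lockstep-skip fs (trTys s As) (trTy s A ∷ Ms) (tyN f ∷ ns) (All¬⇒¬Any f∉fs) (length-trTys s As))
          (cong ⟪ trTy s A ∷ Ms ⟫ (index-tyN-here f ns))
  ... | false | ofⁿ f≢α with α∈
  ...   | here α≡f   = ⊥-elim (f≢α (sym α≡f))
  ...   | there α∈fs = instantiate-tyvar s fs fs! As (trTy s A ∷ Ms) (tyN f ∷ ns) α∈fs

  instantiate-constant : ∀ (s : Scope) (C : Ty) (As : Vec Ty (length (ftv C))) →
    sub ⟪ trTys s As ʳ++ [] ⟫ (trTy (reverse (map tyN (ftv C))) C)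
      ≡ trTy s (tsub (instSub (ftv C) (toList As)) C)
  instantiate-constant s C As =
    sub-trTy _ _ s _ C λ α∈C →
      instantiate-tyvar s (ftv C) (deduplicate-! (tvars C)) As [] [] (∈-deduplicate⁺ _≟_ α∈C)

  mutual
    tvars-tsub : ∀ (ϑ : ℕ → Ty) (C : Ty) {α} → α ∈ tvars (tsub ϑ C) →
                 Σ[ γ ∈ ℕ ] γ ∈ tvars C × α ∈ tvars (ϑ γ)
    tvars-tsub ϑ (tvar γ) α∈ = γ , here refl , α∈
    tvars-tsub ϑ (A ⇒ B) α∈ with ∈-++⁻ (tvars (tsub ϑ A)) α∈
    ... | inj₁ α∈A with tvars-tsub ϑ A α∈A
    ...   | γ , γ∈ , α∈ϑγ = γ , xs⊆xs++ys _ _ γ∈ , α∈ϑγ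
    tvars-tsub ϑ (A ⇒ B) α∈ | inj₂ α∈B with tvars-tsub ϑ B α∈B
    ...   | γ , γ∈ , α∈ϑγ = γ , xs⊆ys++xs _ (tvars A) γ∈ , α∈ϑγ
    tvars-tsub ϑ (tyop p As) α∈ = tvars-tsubV ϑ As α∈

    tvars-tsubV : ∀ (ϑ : ℕ → Ty) {n} (As : Vec Ty n) {α} → α ∈ tvarsV (tsubV ϑ As) →
                  Σ[ γ ∈ ℕ ] γ ∈ tvarsV As × α ∈ tvars (ϑ γ)
    tvars-tsubV ϑ (A ∷ As) α∈ with ∈-++⁻ (tvars (tsub ϑ A)) α∈
    ... | inj₁ α∈A with tvars-tsub ϑ A α∈A
    ...   | γ , γ∈ , α∈ϑγ = γ , xs⊆xs++ys _ _ γ∈ , α∈ϑγ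
    tvars-tsubV ϑ (A ∷ As) α∈ | inj₂ α∈As with tvars-tsubV ϑ As α∈As
    ...   | γ , γ∈ , α∈ϑγ = γ , xs⊆ys++xs _ (tvars A) γ∈ , α∈ϑγ

  tvars-instSub : ∀ fs (As : Vec Ty (length fs)) {γ} → γ ∈ fs →
                  tvars (instSub fs (toList As) γ) ⊆ tvarsV As
  tvars-instSub (f ∷ fs) (A ∷ As) {γ} γ∈ with f ≡ᵇ γ | ≡ᵇ-reflects f γ
  ... | true  | _        = xs⊆xs++ys _ _
  ... | false | ofⁿ f≢γ with γ∈
  ...   | here γ≡f   = ⊥-elim (f≢γ (sym γ≡f))
  ...   | there γ∈fs = xs⊆ys++xs _ (tvars A) ∘ tvars-instSub fs As γ∈fs

  tvars-type⊆ftvTm : ∀ {M : HTm S} {A} → M ⦂ A → tvars A ⊆ ftvTm M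
  tvars-type⊆ftvTm var = ⊆-refl
  tvars-type⊆ftvTm (lam {A = A} ⊢M) = ++⁺ʳ (tvars A) (tvars-type⊆ftvTm ⊢M)
  tvars-type⊆ftvTm (app {A = A} ⊢M ⊢N) =
    xs⊆xs++ys _ _ ∘ tvars-type⊆ftvTm ⊢M ∘ xs⊆ys++xs _ (tvars A)
  tvars-type⊆ftvTm eqC = ++-⊆ ⊆-refl (++-⊆ ⊆-refl λ ())
  tvars-type⊆ftvTm selC = ++-⊆ (++-⊆ ⊆-refl λ ()) ⊆-refl
  tvars-type⊆ftvTm (con {c = c} {As = As}) α∈
    with tvars-tsub (instSub (ftv (ctype S c)) (toList As)) (ctype S c) α∈
  ... | γ , γ∈C , α∈ = tvars-instSub (ftv (ctype S c)) As (∈-deduplicate⁺ _≟_ γ∈C) α∈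

  tvars-fv⊆ftvTm : ∀ (M : HTm S) {x B} → (x , B) ∈ fvTm M → tvars B ⊆ ftvTm M
  tvars-fv⊆ftvTm (var y A) (here refl) = ⊆-refl
  tvars-fv⊆ftvTm (lam y A M) x∈ = xs⊆ys++xs _ (tvars A) ∘ tvars-fv⊆ftvTm M (proj₁ (∈-filter⁻ _ x∈))
  tvars-fv⊆ftvTm (app M N) x∈ with ∈-++⁻ (fvTm M) x∈
  ... | inj₁ x∈M = xs⊆xs++ys _ _ ∘ tvars-fv⊆ftvTm M x∈M
  ... | inj₂ x∈N = xs⊆ys++xs _ (ftvTm M) ∘ tvars-fv⊆ftvTm N x∈N

  fv-lam : ∀ {x A} {M : HTm S} {y C} → (y , C) ∈ fvTm M →
           (y ≡ x × C ≡ A) ⊎ (y , C) ∈ fvTm (lam x A M)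
  fv-lam {x} {A} {y = y} {C} y∈ with (y ≡ᵇ x) ∧ (C ==ty A) in e | tmN-reflects y x C A
  ... | true  | ofʸ y≡x×C≡A = inj₁ y≡x×C≡A
  ... | false | _           = inj₂ (∈-filter⁺ _ y∈ (subst (T ∘ not) (sym e) tt))

  _⊆ᵗʸ_ : List ℕ → Scope → Set
  αs ⊆ᵗʸ s = ∀ {α} → α ∈ αs → tyN α ∈ s

  _⊆ᵗᵐ_ : List (ℕ × Ty) → Scope → Set
  xs ⊆ᵗᵐ s = ∀ {x A} → (x , A) ∈ xs → tmN x A ∈ s

  data TyVarCtx : List Tm → Scope → Set where
    nil : TyVarCtx [] []
    tyv : ∀ {Γ s} α → TyVarCtx Γ s → TyVarCtx (cst type ∷ Γ) (tyN α ∷ s)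

  data ScopedCtx : List Tm → Scope → Set where
    tyvars : ∀ {Γ s} → TyVarCtx Γ s → ScopedCtx Γ s
    tmv    : ∀ {Γ s} x A → ScopedCtx Γ s → ScopedCtx (‖ s ∣ A ‖ ∷ Γ) (tmN x A ∷ s)

  lookup-tyvar₀ : ∀ {Γ s α} → TyVarCtx Γ s → tyN α ∈ s →
                  lookupCtx Γ (index s (tyN α)) ≡ just (cst type)
  lookup-tyvar₀ {α = α} (tyv γ g) α∈ with γ ≡ᵇ α | ≡ᵇ-reflects γ α
  ... | true  | _        = refl
  ... | false | ofⁿ γ≢α with α∈
  ...   | here refl = ⊥-elim (γ≢α refl)
  ...   | there α∈s = lookup-tyvar₀ g α∈s

  lookup-tyvar : ∀ {Γ s α} → ScopedCtx Γ s → tyN α ∈ s →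
                 lookupCtx Γ (index s (tyN α)) ≡ just (cst type)
  lookup-tyvar (tyvars g) α∈ = lookup-tyvar₀ g α∈
  lookup-tyvar (tmv x A g) (there α∈) = lookup-tyvar g α∈

  no-tmvar-in-TyVarCtx : ∀ {Γ s x A} → TyVarCtx Γ s → tmN x A ∉ s
  no-tmvar-in-TyVarCtx (tyv γ g) (there x∈) = no-tmvar-in-TyVarCtx g x∈

  lookup-tmvar : ∀ {Γ s x A} → ScopedCtx Γ s → tmN x A ∈ s →
                 Σ[ E ∈ Tm ] lookupCtx Γ (index s (tmN x A)) ≡ just (cst term · E)
                           × ren (λ k → suc (index s (tmN x A)) + k) E ≡ trTy s A
  lookup-tmvar (tyvars g) x∈ = ⊥-elim (no-tmvar-in-TyVarCtx g x∈)
  lookup-tmvar {x = x} {A} (tmv {s = s} y B g) x∈ with (y ≡ᵇ x) ∧ (B ==ty A) | tmN-reflects y x B A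
  ... | true  | ofʸ (refl , refl) = trTy s B , refl , wk-trTy s y B B
  ... | false | ofⁿ ≢x with x∈
  ...   | here refl  = ⊥-elim (≢x (refl , refl))
  ...   | there x∈s with lookup-tmvar g x∈s
  ...     | E , E∈Γ , E≡A = E , E∈Γ , trans (sym (ren-ren suc _ E)) (trans (cong wk E≡A) (wk-trTy s y B A))

  declare-tyvars : ∀ αs {Γ s} → TyVarCtx Γ s →
                   let (Γ' , s') = addTyVars (Γ , s) αs in TyVarCtx Γ' s' × αs ⊆ᵗʸ s' × s ⊆ s'
  declare-tyvars [] g = g , (λ ()) , (λ v∈ → v∈)
  declare-tyvars (α ∷ αs) g with declare-tyvars αs (tyv α g)
  ... | g' , αs⊆ , s⊆ =
    g' , (λ { (here refl) → s⊆ (here refl) ; (there α∈) → αs⊆ α∈ }) , s⊆ ∘ there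

  module Typing (R : RuleC → Tm) where

    retype : ∀ {Γ M A B} → Typed R Γ M A → A ≡ B → Typed R Γ M B
    retype t refl = t

    tyvar-ctx-wf : ∀ {Γ s} → TyVarCtx Γ s → WF R Γ
    tyvar-ctx-wf nil = ε
    tyvar-ctx-wf (tyv α g) = tyvar-ctx-wf g ▸ cst type (tyvar-ctx-wf g)

    mutual
      type-wt : ∀ {Γ s} → WF R Γ → ScopedCtx Γ s → (A : Ty) → tvars A ⊆ᵗʸ s →
                Typed R Γ (trTy s A) (cst type)
      type-wt w g (tvar α) h = var w (lookup-tyvar g (h (here refl)))
      type-wt w g bool h = cst bool w
      type-wt w g ind h = cst ind w
      type-wt w g (A ⇒ B) h =
        app (app (cst arrow w) (type-wt w g A (h ∘ xs⊆xs++ys _ _)))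
            (type-wt w g B (h ∘ xs⊆ys++xs _ (tvars A)))
      type-wt w g (tyop p As) h =
        instantiate-telescope {Ms = []} w g
          (retype (cst (op p) w) (trans (typeArrows≡piTypes _) (sym (sub-id _)))) As h

      -- Applying F : Π α₁…αₙ : type. B, whose outer binders are already
      -- instantiated by ⟪ Ms ⟫, to |A₁| … |Aₙ| instantiates the rest.
      instantiate-telescope : ∀ {Γ s n B Ms F} → WF R Γ → ScopedCtx Γ s →
        Typed R Γ F (sub ⟪ Ms ⟫ (piTypes n B)) → (As : Vec Ty n) → tvarsV As ⊆ᵗʸ s →
        Typed R Γ (apps F (trTys s As)) (sub ⟪ trTys s As ʳ++ Ms ⟫ B)
      instantiate-telescope w g t [] h = t
      instantiate-telescope {s = s} {suc n} {B} {Ms} w g t (A ∷ As) h =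
        instantiate-telescope w g (retype (app t (type-wt w g A (h ∘ xs⊆xs++ys _ _))) instantiate-A)
                              As (h ∘ xs⊆ys++xs _ (tvars A))
        where
          instantiate-A : sub (exts ⟪ Ms ⟫) (piTypes n B) [ trTy s A ]₀
                          ≡ sub ⟪ trTy s A ∷ Ms ⟫ (piTypes n B)
          instantiate-A = trans (sub-sub _ _ (piTypes n B))
                                (sub-cong (exts-[]₀ (trTy s A) ⟪ Ms ⟫) (piTypes n B))

    term-wt : ∀ {Γ s} → WF R Γ → ScopedCtx Γ s → (A : Ty) → tvars A ⊆ᵗʸ s →
              Typed R Γ ‖ s ∣ A ‖ TYPE
    term-wt w g A h = app (cst term w) (type-wt w g A h)

    -- ‖A‖ ⟶ ‖B‖ : Type; the codomain is checked under a dummy declaration of ‖A‖.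
    arrow-wt : ∀ {Γ s} → WF R Γ → ScopedCtx Γ s → (A B : Ty) → tvars (A ⇒ B) ⊆ᵗʸ s →
               Typed R Γ (‖ s ∣ A ‖ ⟶ ‖ s ∣ B ‖) TYPE
    arrow-wt {Γ} {s} w g A B h =
      pi sType ⊢A (subst (λ E → Typed R (‖ s ∣ A ‖ ∷ Γ) (cst term · E) TYPE)
                         (sym (wk-trTy s 0 A B)) ⊢B)
      where
        ⊢A = term-wt w g A (h ∘ xs⊆xs++ys _ _)
        ⊢B = term-wt (w ▸ ⊢A) (tmv 0 A g) B (there ∘ h ∘ xs⊆ys++xs _ (tvars A))

    translation-typed : ∀ {Γ s M A} → WF R Γ → ScopedCtx Γ s → M ⦂ A →
                        ftvTm M ⊆ᵗʸ s → fvTm M ⊆ᵗᵐ s → Typed R Γ (trTm s M) ‖ s ∣ A ‖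
    translation-typed w g var htv hfv with lookup-tmvar g (hfv (here refl))
    ... | E , E∈Γ , E≡A = retype (var w E∈Γ) (cong (cst term ·_) E≡A)
    translation-typed {s = s} w g ⊢λ@(lam {x} {A} {M} {B} ⊢M) htv hfv =
      conv (lam ⊢A ⊢body) (term-wt w g (A ⇒ B) (htv ∘ tvars-type⊆ftvTm ⊢λ)) (bwd rw ◅ ε)
      where
        ⊢A = term-wt w g A (htv ∘ xs⊆xs++ys _ _)
        body-fv : fvTm M ⊆ᵗᵐ (tmN x A ∷ s)
        body-fv {y} {C} y∈ with fv-lam {x} {A} {M} {y} {C} y∈
        ... | inj₁ (refl , refl) = here refl
        ... | inj₂ y∈λ           = there (hfv y∈λ)
        ⊢body = retype (translation-typed (w ▸ ⊢A) (tmv x A g) ⊢M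
                                          (there ∘ htv ∘ xs⊆ys++xs _ (tvars A)) body-fv)
                       (cong (cst term ·_) (sym (wk-trTy s x A B)))
    translation-typed {s = s} w g (app {M} {N} {A} {B} ⊢M ⊢N) htv hfv =
      retype (app (conv ⊢|M| (arrow-wt w g A B tvars-A⇒B) (fwd rw ◅ ε)) ⊢|N|)
             (cong (cst term ·_) (sub-wk (λ _ → refl) (trTy s B)))
      where
        ⊢|M| = translation-typed w g ⊢M (htv ∘ xs⊆xs++ys _ _) (hfv ∘ xs⊆xs++ys _ _)
        ⊢|N| = translation-typed w g ⊢N (htv ∘ xs⊆ys++xs _ (ftvTm M)) (hfv ∘ xs⊆ys++xs _ (fvTm M))
        tvars-A⇒B : tvars (A ⇒ B) ⊆ᵗʸ s
        tvars-A⇒B = htv ∘ xs⊆xs++ys _ _ ∘ tvars-type⊆ftvTm ⊢M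
    translation-typed w g (eqC {A}) htv hfv = app (cst eq w) (type-wt w g A htv)
    translation-typed w g (selC {A}) htv hfv = app (cst select w) (type-wt w g A htv)
    translation-typed {s = s} w g (con {c} {As}) htv hfv =
      retype (instantiate-telescope {Ms = []} w g (retype (cst (con c) w) (sym (sub-id _))) As htv)
             (cong (cst term ·_) (instantiate-constant s (ctype S c) As))

    declare-tmvars : ∀ xs {Γ s} → WF R Γ → ScopedCtx Γ s →
                     (∀ {x A} → (x , A) ∈ xs → tvars A ⊆ᵗʸ s) →
                     let (Γ' , s') = addTmVars (Γ , s) xs
                     in WF R Γ' × ScopedCtx Γ' s' × xs ⊆ᵗᵐ s' × s ⊆ s'
    declare-tmvars [] w g h = w , g , (λ ()) , (λ v∈ → v∈)
    declare-tmvars ((x , A) ∷ xs) w g h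
      with declare-tmvars xs (w ▸ term-wt w g A (h (here refl))) (tmv x A g) (λ y∈ → there ∘ h (there y∈))
    ... | w' , g' , xs⊆ , s⊆ =
      w' , g' , (λ { (here refl) → s⊆ (here refl) ; (there y∈) → xs⊆ y∈ }) , s⊆ ∘ there

open Typing

-- Only
-- the inclusions of the variables of M into αs and xs are needed.
lemma14 : (S : HOLSig) (R : RuleC → DTm S) (M : HTm S) (A : HTy (tsig S)) → M ⦂ A →
          (αs : List ℕ) → Unique αs → (∀ α → (α ∈ αs → α ∈ ftvTm M) × (α ∈ ftvTm M → α ∈ αs)) →
          (xs : List (ℕ × HTy (tsig S))) → Unique xs → (∀ v → (v ∈ xs → v ∈ fvTm M) × (v ∈ fvTm M → v ∈ xs)) →
          Typed R (proj₁ (holCtx αs xs)) (trTm (proj₂ (holCtx αs xs)) M) ‖ proj₂ (holCtx αs xs) ∣ A ‖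
lemma14 S R M A ⊢M αs _ αs≈ftv xs _ xs≈fv =
  let ftv⊆αs : ftvTm M ⊆ αs
      ftv⊆αs = proj₂ (αs≈ftv _)
      (g₁ , αs⊆s₁ , _) = declare-tyvars αs nil
      tvars-xs : ∀ {x B} → (x , B) ∈ xs → tvars B ⊆ᵗʸ proj₂ (addTyVars ([] , []) αs)
      tvars-xs x∈ = αs⊆s₁ ∘ ftv⊆αs ∘ tvars-fv⊆ftvTm M (proj₁ (xs≈fv _) x∈)
      (w , g , xs⊆s , s₁⊆s) = declare-tmvars R xs (tyvar-ctx-wf R g₁) (tyvars g₁) tvars-xs
  in translation-typed R w g ⊢M (s₁⊆s ∘ αs⊆s₁ ∘ ftv⊆αs) (xs⊆s ∘ proj₂ (xs≈fv _))
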